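{- Let $n = rq$ where $r\geq 1$ is an integer and $q>1$ is odd, and let $G = C_n(S)$ be a circulant graph with $S\subseteq\{1,\ldots,\lfloor n/2\rfloor\}$ that is not complete. Then: (1) If $\{r, 2r, \ldots, \tfrac{q-1}{2} r\} \not\subseteq S$, then $\omega(G) \leq \frac{n-r}{2}$. (2) If $\omega(G) < q$, then $\{r, 2r, \ldots, \tfrac{q-1}{2} r\} \not\subseteq S$.
   Context: For $S \subseteq \{1,\ldots,\lfloor n/2\rfloor\}$, the circulant graph $C_n(S)$ is the simple graph with vertex set $\mathbb{Z}_n=\{0,\ldots,n-1\}$ and edge set $\{\{i,j\} : |j-i|_n \in S\}$, where $|k|_n=\min\{|k|, n-|k|\}$. $\omega(G)$ denotes the maximum cardinality of a clique (set of pairwise adjacent vertices) of $G$. -}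

module Defs where

open import Data.Nat using (ℕ; _+_; _*_; _∸_; _≤_; _<_; ∣_-_∣; _⊓_; _/_)
open import Data.Fin using (Fin; toℕ)
open import Data.Fin.Subset using (Subset; _∈_)
open import Data.Product using (_×_)
open import Relation.Binary.PropositionalEquality using (_≡_; _≢_)

circDist : (n : ℕ) → Fin n → Fin n → ℕ
circDist n i j = ∣ toℕ j - toℕ i ∣ ⊓ (n ∸ ∣ toℕ j - toℕ i ∣)

ValidConnSet : (n : ℕ) → (ℕ → Set) → Set
ValidConnSet n S = ∀ s → S s → (1 ≤ s) × (s ≤ n / 2)

Adj : (n : ℕ) → (ℕ → Set) → Fin n → Fin n → Set
Adj n S i j = S (circDist n i j)

IsComplete : (n : ℕ) → (ℕ → Set) → Set
IsComplete n S = ∀ (i j : Fin n) → i ≢ j → Adj n S i j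

IsClique : (n : ℕ) → (ℕ → Set) → Subset n → Set
IsClique n S C = ∀ (i j : Fin n) → i ∈ C → j ∈ C → i ≢ j → Adj n S i j

MultiplesIn : (r q : ℕ) → (ℕ → Set) → Set
MultiplesIn r q S = ∀ (k : ℕ) → 1 ≤ k → k ≤ (q ∸ 1) / 2 → S (k * r)

-- Inside one residue class mod r, the vertices j r + a (j < q) form a q-cycle in which
-- distance k r joins j and j + k mod q.  If k r ∉ S, a clique meets each class in a set
-- containing no two points k apart on the cycle; double counting the pairs {j, j + k}
-- bounds such a set by q / 2, hence by (q - 1) / 2 as q is odd, and summing over the r
-- classes gives 2 ω ≤ r q - r.  Conversely the multiples of r form a q-clique as soon as
-- all of r, 2r, …, ((q - 1) / 2) r lie in S.
module Submission where

open import Defs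
open import Data.Bool using (Bool; true; false)
open import Data.Empty using (⊥-elim)
open import Data.Fin using (Fin; toℕ) renaming (zero to fzero; suc to fsuc)
open import Data.Fin.Properties using (toℕ-injective; toℕ<n; any?)
open import Data.Fin.Subset using (Subset; ∣_∣; _∈_)
open import Data.Fin.Subset.Properties using (_∈?_)
open import Data.Nat using (ℕ; zero; suc; _+_; _*_; _∸_; _≤_; _<_; _⊓_; ∣_-_∣; _/_; _≟_; _≤?_; z≤n; s≤s)
open import Data.Nat.Properties
open import Data.Nat.DivMod using (m/n*n≤m; m*n/n≡m; /-monoˡ-≤)
open import Data.Nat.Divisibility using (_∣_; _∣?_; divides; n∣m*n; ∣m+n∣m⇒∣n; ∣⇒≤)
open import Data.Nat.Solver using (module +-*-Solver)
open import Data.Product using (_×_; _,_; ∃-syntax)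
open import Data.Sum using (_⊎_; inj₁; inj₂; fromInj₂)
open import Data.Vec using ([]; _∷_)
open import Data.Vec.Base using (here; there)
open import Function using (_∘_)
open import Relation.Nullary using (¬_; Dec; yes; no; does)
open import Relation.Nullary.Decidable using (_×-dec_; dec-true; dec-false)
open import Relation.Unary using (Decidable)
open import Relation.Binary.PropositionalEquality
open +-*-Solver using (solve; _:+_; _:*_; _:=_)

∑ : ℕ → (ℕ → ℕ) → ℕ
∑ zero    f = 0
∑ (suc m) f = f 0 + ∑ m (f ∘ suc)

infix 5 ∑
syntax ∑ m (λ j → e) = ∑[ j < m ] e

∑-cong : ∀ {f g} m → (∀ j → j < m → f j ≡ g j) → ∑ m f ≡ ∑ m g
∑-cong zero    f≡g = refl
∑-cong (suc m) f≡g = cong₂ _+_ (f≡g 0 (s≤s z≤n)) (∑-cong m (λ j j<m → f≡g (suc j) (s≤s j<m)))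

∑-mono-≤ : ∀ {f g} m → (∀ j → j < m → f j ≤ g j) → ∑ m f ≤ ∑ m g
∑-mono-≤ zero    f≤g = z≤n
∑-mono-≤ (suc m) f≤g = +-mono-≤ (f≤g 0 (s≤s z≤n)) (∑-mono-≤ m (λ j j<m → f≤g (suc j) (s≤s j<m)))

∑-const : ∀ c m → ∑[ _ < m ] c ≡ m * c
∑-const c zero    = refl
∑-const c (suc m) = cong (c +_) (∑-const c m)

∑-split : ∀ f m p → ∑ (m + p) f ≡ ∑ m f + (∑[ j < p ] f (m + j))
∑-split f zero    p = refl
∑-split f (suc m) p = trans (cong (f 0 +_) (∑-split (f ∘ suc) m p)) (sym (+-assoc (f 0) _ _))

∑-distrib-+ : ∀ f g m → ∑[ j < m ] f j + g j ≡ ∑ m f + ∑ m g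
∑-distrib-+ f g zero    = refl
∑-distrib-+ f g (suc m) = begin
  (f 0 + g 0) + (∑[ j < m ] f (suc j) + g (suc j))
    ≡⟨ cong (f 0 + g 0 +_) (∑-distrib-+ (f ∘ suc) (g ∘ suc) m) ⟩
  (f 0 + g 0) + (F + G)
    ≡⟨ solve 4 (λ a b c d → (a :+ b) :+ (c :+ d) := (a :+ c) :+ (b :+ d)) refl (f 0) (g 0) F G ⟩
  (f 0 + F) + (g 0 + G) ∎
  where
  open ≡-Reasoning
  F G : ℕ
  F = ∑ m (f ∘ suc)
  G = ∑ m (g ∘ suc)

*-distribˡ-∑ : ∀ c f m → c * ∑ m f ≡ ∑[ j < m ] c * f j
*-distribˡ-∑ c f zero    = *-zeroʳ c
*-distribˡ-∑ c f (suc m) = trans (*-distribˡ-+ c (f 0) _) (cong (c * f 0 +_) (*-distribˡ-∑ c (f ∘ suc) m))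

∑-comm : ∀ (h : ℕ → ℕ → ℕ) q r → ∑[ j < q ] ∑ r (h j) ≡ ∑[ a < r ] ∑[ j < q ] h j a
∑-comm h zero    r = sym (trans (∑-const 0 r) (*-zeroʳ r))
∑-comm h (suc q) r = trans (cong (∑ r (h 0) +_) (∑-comm (h ∘ suc) q r)) (sym (∑-distrib-+ (h 0) _ r))

∑-blocks : ∀ f q r → ∑ (q * r) f ≡ ∑[ j < q ] ∑[ a < r ] f (j * r + a)
∑-blocks f zero    r = refl
∑-blocks f (suc q) r = begin
  ∑ (r + q * r) f
    ≡⟨ ∑-split f r (q * r) ⟩
  ∑ r f + (∑[ x < q * r ] f (r + x))
    ≡⟨ cong (∑ r f +_) (∑-blocks (f ∘ (r +_)) q r) ⟩
  ∑ r f + (∑[ j < q ] ∑[ a < r ] f (r + (j * r + a)))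
    ≡⟨ cong (∑ r f +_) (∑-cong q λ j _ → ∑-cong r λ a _ → cong f (sym (+-assoc r (j * r) a))) ⟩
  ∑ r f + (∑[ j < q ] ∑[ a < r ] f (suc j * r + a)) ∎
  where open ≡-Reasoning

∑-residues : ∀ f q r → ∑ (r * q) f ≡ ∑[ a < r ] ∑[ j < q ] f (j * r + a)
∑-residues f q r = trans (cong (λ l → ∑ l f) (*-comm r q)) (trans (∑-blocks f q r) (∑-comm _ q r))

-- Each j < k + m lies in exactly two of the pairs {j, k + j} (j < m) and {j, m + j} (j < k).
rotation-bound : ∀ (f : ℕ → ℕ) k m →
                 (∀ j → j < m → f j + f (k + j) ≤ 1) → (∀ j → j < k → f j + f (m + j) ≤ 1) →
                 2 * ∑ (k + m) f ≤ k + m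
rotation-bound f k m pairsₖ pairsₘ = begin
  2 * ∑ (k + m) f
    ≡⟨ cong₂ (λ x y → x + (y + 0)) (∑-split f k m) (trans (cong (λ l → ∑ l f) (+-comm k m)) (∑-split f m k)) ⟩
  (A + B) + ((C + D) + 0)
    ≡⟨ solve 4 (λ a b c d → (a :+ b) :+ ((c :+ d) :+ con 0) := (c :+ b) :+ (a :+ d)) refl A B C D ⟩
  (C + B) + (A + D)
    ≡⟨ sym (cong₂ _+_ (∑-distrib-+ f (f ∘ (k +_)) m) (∑-distrib-+ f (f ∘ (m +_)) k)) ⟩
  (∑[ j < m ] f j + f (k + j)) + (∑[ j < k ] f j + f (m + j))
    ≤⟨ +-mono-≤ (∑-mono-≤ m pairsₖ) (∑-mono-≤ k pairsₘ) ⟩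
  (∑[ _ < m ] 1) + (∑[ _ < k ] 1)
    ≡⟨ cong₂ _+_ (trans (∑-const 1 m) (*-identityʳ m)) (trans (∑-const 1 k) (*-identityʳ k)) ⟩
  m + k
    ≡⟨ +-comm m k ⟩
  k + m ∎
  where
  open ≤-Reasoning
  open +-*-Solver using (con)
  A B C D : ℕ
  A = ∑ k f
  B = ∑[ j < m ] f (k + j)
  C = ∑ m f
  D = ∑[ j < k ] f (m + j)

2*m≤n⇒2*m<n : ∀ m {n} → ¬ 2 ∣ n → 2 * m ≤ n → 2 * m < n
2*m≤n⇒2*m<n m odd 2m≤n with m≤n⇒m<n∨m≡n 2m≤n
... | inj₁ 2m<n = 2m<n
... | inj₂ refl = ⊥-elim (odd (divides m (*-comm 2 m)))

m≤n/2⇒2*m≤n : ∀ {m} n → m ≤ n / 2 → 2 * m ≤ n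
m≤n/2⇒2*m≤n {m} n m≤n/2 = ≤-trans (subst (_≤ n / 2 * 2) (*-comm m 2) (*-monoˡ-≤ 2 m≤n/2)) (m/n*n≤m n 2)

2*m≤n⇒m≤n/2 : ∀ {m} n → 2 * m ≤ n → m ≤ n / 2
2*m≤n⇒m≤n/2 {m} n 2m≤n = subst (_≤ n / 2) (trans (cong (_/ 2) (*-comm 2 m)) (m*n/n≡m m 2)) (/-monoˡ-≤ 2 2m≤n)

2*m≤n⇒m≤n∸m : ∀ {m n} → 2 * m ≤ n → m ≤ n ∸ m
2*m≤n⇒m≤n∸m {m} {n} 2m≤n = m+n≤o⇒m≤o∸n m (subst (_≤ n) (cong (m +_) (+-identityʳ m)) 2m≤n)

circDistℕ : ℕ → ℕ → ℕ → ℕ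
circDistℕ n a b = ∣ b - a ∣ ⊓ (n ∸ ∣ b - a ∣)

circDistℕ-offset : ∀ {n x D E} → n ≡ D + E → circDistℕ n x (x + D) ≡ D ⊓ E
circDistℕ-offset {x = x} {D} {E} refl rewrite ∣-∣-comm (x + D) x | ∣m-m+n∣≡n x D = cong (D ⊓_) (m+n∸m≡n D E)

circDistℕ-*ʳ : ∀ q r a b → circDistℕ (q * r) (a * r) (b * r) ≡ circDistℕ q a b * r
circDistℕ-*ʳ q r a b = begin
  ∣ b * r - a * r ∣ ⊓ (q * r ∸ ∣ b * r - a * r ∣) ≡⟨ cong (λ x → x ⊓ (q * r ∸ x)) (sym (*-distribʳ-∣-∣ r b a)) ⟩
  d * r ⊓ (q * r ∸ d * r)                       ≡⟨ cong (d * r ⊓_) (sym (*-distribʳ-∸ r q d)) ⟩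
  d * r ⊓ ((q ∸ d) * r)                         ≡⟨ sym (*-distribʳ-⊓ r d (q ∸ d)) ⟩
  (d ⊓ (q ∸ d)) * r                             ∎
  where
  open ≡-Reasoning
  d : ℕ
  d = ∣ b - a ∣

∣m-n∣<o : ∀ {m n o} → m < o → n < o → ∣ m - n ∣ < o
∣m-n∣<o {m} {n} m<o n<o = ≤-<-trans (∣m-n∣≤m⊔n m n) (⊔-lub m<o n<o)

circDistℕ-pos : ∀ {q a b} → a < q → b < q → a ≢ b → 1 ≤ circDistℕ q a b
circDistℕ-pos {q} {a} {b} a<q b<q a≢b =
  ⊓-glb (n≢0⇒n>0 (a≢b ∘ sym ∘ ∣m-n∣≡0⇒m≡n)) (m<n⇒0<n∸m (∣m-n∣<o b<q a<q))

2*circDistℕ≤ : ∀ {q a b} → a < q → b < q → 2 * circDistℕ q a b ≤ q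
2*circDistℕ≤ {q} {a} {b} a<q b<q = begin
  e + (e + 0)         ≡⟨ cong (e +_) (+-identityʳ e) ⟩
  e + e               ≤⟨ +-mono-≤ (m⊓n≤m d (q ∸ d)) (m⊓n≤n d (q ∸ d)) ⟩
  d + (q ∸ d)         ≡⟨ m+[n∸m]≡n (<⇒≤ (∣m-n∣<o b<q a<q)) ⟩
  q                   ∎
  where
  open ≤-Reasoning
  d e : ℕ
  d = ∣ b - a ∣
  e = circDistℕ q a b

𝟙 : Bool → ℕ
𝟙 true  = 1
𝟙 false = 0

-- The indicator of a subset, read as a function on ℕ that vanishes beyond its length.
χ : ∀ {m} → Subset m → ℕ → ℕ
χ []      _       = 0
χ (b ∷ _) zero    = 𝟙 b
χ (_ ∷ p) (suc x) = χ p x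

∣∷∣ : ∀ {m} b (p : Subset m) → ∣ b ∷ p ∣ ≡ 𝟙 b + ∣ p ∣
∣∷∣ true  p = refl
∣∷∣ false p = refl

∣p∣≡∑χ : ∀ {m} (p : Subset m) → ∣ p ∣ ≡ ∑ m (χ p)
∣p∣≡∑χ []      = refl
∣p∣≡∑χ (b ∷ p) = trans (∣∷∣ b p) (cong (𝟙 b +_) (∣p∣≡∑χ p))

χ≤1 : ∀ {m} (p : Subset m) x → χ p x ≤ 1
χ≤1 []          x       = z≤n
χ≤1 (true ∷ _)  zero    = s≤s z≤n
χ≤1 (false ∷ _) zero    = z≤n
χ≤1 (_ ∷ p)     (suc x) = χ≤1 p x

χ≡0⊎∈ : ∀ {m} (p : Subset m) x → χ p x ≡ 0 ⊎ ∃[ i ] toℕ i ≡ x × i ∈ p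
χ≡0⊎∈ []          x       = inj₁ refl
χ≡0⊎∈ (true ∷ _)  zero    = inj₂ (fzero , refl , here)
χ≡0⊎∈ (false ∷ _) zero    = inj₁ refl
χ≡0⊎∈ (_ ∷ p)     (suc x) with χ≡0⊎∈ p x
... | inj₁ χ≡0           = inj₁ χ≡0
... | inj₂ (i , refl , i∈p) = inj₂ (fsuc i , refl , there i∈p)

Separated : ∀ {m} → Subset m → ℕ → Set
Separated p D = ∀ x → χ p x + χ p (x + D) ≤ 1

MembersAtOffset : ∀ {m} → Subset m → ℕ → Set
MembersAtOffset p D = ∃[ i ] i ∈ p × ∃[ j ] j ∈ p × toℕ j ≡ toℕ i + D

membersAtOffset? : ∀ {m} (p : Subset m) D → Dec (MembersAtOffset p D)
membersAtOffset? p D = any? λ i → i ∈? p ×-dec any? λ j → j ∈? p ×-dec toℕ j ≟ toℕ i + D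

¬membersAtOffset⇒separated : ∀ {m} (p : Subset m) D → ¬ MembersAtOffset p D → Separated p D
¬membersAtOffset⇒separated p D ¬pair x with χ≡0⊎∈ p x | χ≡0⊎∈ p (x + D)
... | inj₁ χx≡0 | _ rewrite χx≡0 = χ≤1 p (x + D)
... | inj₂ _ | inj₁ χy≡0 rewrite χy≡0 | +-identityʳ (χ p x) = χ≤1 p x
... | inj₂ (i , refl , i∈p) | inj₂ (j , j≡ , j∈p) = ⊥-elim (¬pair (i , i∈p , j , j∈p , j≡))

toSubset : {P : ℕ → Set} → Decidable P → (m : ℕ) → Subset m
toSubset P? zero    = []
toSubset P? (suc m) = does (P? 0) ∷ toSubset (P? ∘ suc) m

∣toSubset∣ : ∀ {P} (P? : Decidable P) m → ∣ toSubset P? m ∣ ≡ ∑[ x < m ] 𝟙 (does (P? x))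
∣toSubset∣ P? zero    = refl
∣toSubset∣ P? (suc m) =
  trans (∣∷∣ (does (P? 0)) (toSubset (P? ∘ suc) m)) (cong (𝟙 (does (P? 0)) +_) (∣toSubset∣ (P? ∘ suc) m))

∈toSubset : ∀ {P} (P? : Decidable P) m (i : Fin m) → i ∈ toSubset P? m → P (toℕ i)
∈toSubset P? (suc m) fzero    i∈ with P? 0 | i∈
... | yes P0 | _ = P0
... | no _   | ()
∈toSubset P? (suc m) (fsuc i) (there i∈) = ∈toSubset (P? ∘ suc) m i i∈

clique-offset⇒S : ∀ {n S C} → IsClique n S C →
                  ∀ {D E} → n ≡ D + E → 1 ≤ D → MembersAtOffset C D → S (D ⊓ E)
clique-offset⇒S {S = S} clique {D} n≡D+E 1≤D (i , i∈C , j , j∈C , j≡i+D) =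
  subst S (trans (cong (circDistℕ _ (toℕ i)) j≡i+D) (circDistℕ-offset {x = toℕ i} n≡D+E))
    (clique i j i∈C j∈C i≢j)
  where
  i≢j : i ≢ j
  i≢j refl = <-irrefl j≡i+D (m<m+n (toℕ i) 1≤D)

separated⇒bound : ∀ r q k m (C : Subset (r * q)) → q ≡ k + m → ¬ 2 ∣ q →
                  Separated C (k * r) → Separated C (m * r) → 2 * ∣ C ∣ ≤ r * q ∸ r
separated⇒bound r q k m C q≡k+m odd sepₖ sepₘ = begin
  2 * ∣ C ∣                                     ≡⟨ cong (2 *_) (trans (∣p∣≡∑χ C) (∑-residues (χ C) q r)) ⟩
  2 * (∑[ a < r ] ∑[ j < q ] χ C (j * r + a))   ≡⟨ *-distribˡ-∑ 2 _ r ⟩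
  (∑[ a < r ] 2 * (∑[ j < q ] χ C (j * r + a))) ≤⟨ ∑-mono-≤ r (λ a _ → residue-bound a) ⟩
  (∑[ _ < r ] q ∸ 1)                            ≡⟨ ∑-const (q ∸ 1) r ⟩
  r * (q ∸ 1)                                   ≡⟨ *-distribˡ-∸ r q 1 ⟩
  r * q ∸ r * 1                                 ≡⟨ cong (r * q ∸_) (*-identityʳ r) ⟩
  r * q ∸ r                                     ∎
  where
  open ≤-Reasoning
  shift : ∀ j l a → j * r + a + l * r ≡ (l + j) * r + a
  shift j l a = solve 4 (λ j l a r → j :* r :+ a :+ l :* r := (l :+ j) :* r :+ a) refl j l a r
  residue-bound : ∀ a → 2 * (∑[ j < q ] χ C (j * r + a)) ≤ q ∸ 1
  residue-bound a = <⇒≤pred (2*m≤n⇒2*m<n (∑ q g) odd (subst (λ l → 2 * ∑ l g ≤ l) (sym q≡k+m) 2∑g≤k+m))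
    where
    g : ℕ → ℕ
    g j = χ C (j * r + a)
    2∑g≤k+m : 2 * ∑ (k + m) g ≤ k + m
    2∑g≤k+m = rotation-bound g k m
      (λ j _ → subst (λ y → g j + χ C y ≤ 1) (shift j k a) (sepₖ (j * r + a)))
      (λ j _ → subst (λ y → g j + χ C y ≤ 1) (shift j m a) (sepₘ (j * r + a)))

clique-bound⊎S : ∀ r q k m (S : ℕ → Set) (C : Subset (r * q)) → IsClique (r * q) S C →
                 1 ≤ r → ¬ 2 ∣ q → q ≡ k + m → 1 ≤ k → k ≤ m →
                 2 * ∣ C ∣ ≤ r * q ∸ r ⊎ S (k * r)
clique-bound⊎S r q k m S C clique 1≤r odd q≡k+m 1≤k k≤m =
  bound⊎S (membersAtOffset? C (k * r)) (membersAtOffset? C (m * r))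
  where
  kr≤mr : k * r ≤ m * r
  kr≤mr = *-monoˡ-≤ r k≤m
  1≤kr : 1 ≤ k * r
  1≤kr = *-mono-≤ 1≤k 1≤r
  n≡kr+mr : r * q ≡ k * r + m * r
  n≡kr+mr = trans (cong (r *_) q≡k+m) (solve 3 (λ r k m → r :* (k :+ m) := k :* r :+ m :* r) refl r k m)
  bound⊎S : Dec (MembersAtOffset C (k * r)) → Dec (MembersAtOffset C (m * r)) →
            2 * ∣ C ∣ ≤ r * q ∸ r ⊎ S (k * r)
  bound⊎S (yes pairₖ) _ =
    inj₂ (subst S (m≤n⇒m⊓n≡m kr≤mr) (clique-offset⇒S {S = S} clique n≡kr+mr 1≤kr pairₖ))
  bound⊎S _ (yes pairₘ) =
    inj₂ (subst S (m≥n⇒m⊓n≡n kr≤mr)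
      (clique-offset⇒S {S = S} clique (trans n≡kr+mr (+-comm (k * r) (m * r))) (≤-trans 1≤kr kr≤mr) pairₘ))
  bound⊎S (no ¬pairₖ) (no ¬pairₘ) =
    inj₁ (separated⇒bound r q k m C q≡k+m odd
      (¬membersAtOffset⇒separated C (k * r) ¬pairₖ) (¬membersAtOffset⇒separated C (m * r) ¬pairₘ))

clique-bound : ∀ r q → 1 ≤ r → ¬ 2 ∣ q → (S : ℕ → Set) → ¬ MultiplesIn r q S →
               ∀ (C : Subset (r * q)) → IsClique (r * q) S C → 2 * ∣ C ∣ ≤ r * q ∸ r
-- S is not decidable, so S (k r) can only come from the pair found by clique-bound⊎S.
clique-bound r q 1≤r odd S ¬multiples C clique with 2 * ∣ C ∣ ≤? r * q ∸ r
... | yes bound = bound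
... | no ¬bound = ⊥-elim (¬multiples multiples)
  where
  multiples : MultiplesIn r q S
  multiples k 1≤k k≤[q∸1]/2 = fromInj₂ (⊥-elim ∘ ¬bound)
    (clique-bound⊎S r q k (q ∸ k) S C clique 1≤r odd (sym (m+[n∸m]≡n k≤q)) 1≤k (2*m≤n⇒m≤n∸m 2k≤q))
    where
    2k≤q : 2 * k ≤ q
    2k≤q = ≤-trans (m≤n/2⇒2*m≤n (q ∸ 1) k≤[q∸1]/2) (m∸n≤m q 1)
    k≤q : k ≤ q
    k≤q = m+n≤o⇒m≤o k 2k≤q

multiplesOf : (r q : ℕ) → Subset (r * q)
multiplesOf r q = toSubset (r ∣?_) (r * q)

∣multiplesOf∣ : ∀ r q → 1 ≤ r → ∣ multiplesOf r q ∣ ≡ q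
∣multiplesOf∣ (suc r) q _ = begin
  ∣ multiplesOf (suc r) q ∣
    ≡⟨ trans (∣toSubset∣ (suc r ∣?_) (suc r * q)) (∑-residues _ q (suc r)) ⟩
  (∑[ j < q ] 𝟙 (does (suc r ∣? j * suc r + 0)))
    + (∑[ a < r ] ∑[ j < q ] 𝟙 (does (suc r ∣? j * suc r + suc a)))
    ≡⟨ cong₂ _+_ (∑-cong q λ j _ → cong 𝟙 (dec-true (suc r ∣? _) (multiple j)))
                 (∑-cong r λ a a<r → ∑-cong q λ j _ → cong 𝟙 (dec-false (suc r ∣? _) (non-multiple j a<r))) ⟩
  (∑[ _ < q ] 1) + (∑[ _ < r ] ∑[ _ < q ] 0)
    ≡⟨ cong₂ _+_ (trans (∑-const 1 q) (*-identityʳ q))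
                 (trans (∑-cong r λ _ _ → trans (∑-const 0 q) (*-zeroʳ q)) (trans (∑-const 0 r) (*-zeroʳ r))) ⟩
  q + 0
    ≡⟨ +-identityʳ q ⟩
  q ∎
  where
  open ≡-Reasoning
  multiple : ∀ j → suc r ∣ j * suc r + 0
  multiple j = subst (suc r ∣_) (sym (+-identityʳ _)) (n∣m*n j)
  non-multiple : ∀ j {a} → a < r → ¬ suc r ∣ j * suc r + suc a
  non-multiple j a<r r∣ = <⇒≱ (s≤s a<r) (∣⇒≤ (∣m+n∣m⇒∣n r∣ (n∣m*n j)))

multiplesOf-clique : ∀ r q → ¬ 2 ∣ q → (S : ℕ → Set) → MultiplesIn r q S →
                     IsClique (r * q) S (multiplesOf r q)
multiplesOf-clique r q odd S multiples i j i∈ j∈ i≢j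
  with ∈toSubset (r ∣?_) (r * q) i i∈ | ∈toSubset (r ∣?_) (r * q) j j∈
... | divides a i≡ar | divides b j≡br =
  subst S (sym circDist≡er) (multiples e (circDistℕ-pos a<q b<q a≢b) e≤[q∸1]/2)
  where
  e : ℕ
  e = circDistℕ q a b
  <q : ∀ {c} (v : Fin (r * q)) → toℕ v ≡ c * r → c < q
  <q {c} v v≡cr = *-cancelʳ-< r c q (subst₂ _<_ v≡cr (*-comm r q) (toℕ<n v))
  a<q : a < q
  a<q = <q i i≡ar
  b<q : b < q
  b<q = <q j j≡br
  a≢b : a ≢ b
  a≢b refl = i≢j (toℕ-injective (trans i≡ar (sym j≡br)))
  e≤[q∸1]/2 : e ≤ (q ∸ 1) / 2
  e≤[q∸1]/2 = 2*m≤n⇒m≤n/2 (q ∸ 1) (<⇒≤pred (2*m≤n⇒2*m<n e odd (2*circDistℕ≤ a<q b<q)))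
  circDist≡er : circDist (r * q) i j ≡ e * r
  circDist≡er = begin
    circDistℕ (r * q) (toℕ i) (toℕ j) ≡⟨ cong₂ (circDistℕ (r * q)) i≡ar j≡br ⟩
    circDistℕ (r * q) (a * r) (b * r) ≡⟨ cong (λ n → circDistℕ n (a * r) (b * r)) (*-comm r q) ⟩
    circDistℕ (q * r) (a * r) (b * r) ≡⟨ circDistℕ-*ʳ q r a b ⟩
    e * r                             ∎
    where open ≡-Reasoning

lemma2p5 : (r q : ℕ) → 1 ≤ r → 1 < q → ¬ (2 ∣ q) →
    (S : ℕ → Set) → ValidConnSet (r * q) S → ¬ IsComplete (r * q) S →
    (¬ MultiplesIn r q S →
        ∀ (C : Subset (r * q)) → IsClique (r * q) S C → 2 * ∣ C ∣ ≤ r * q ∸ r)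
    × ((∀ (C : Subset (r * q)) → IsClique (r * q) S C → ∣ C ∣ < q) →
        ¬ MultiplesIn r q S)
lemma2p5 r q 1≤r _ odd S _ _ = clique-bound r q 1≤r odd S , ω<q⇒¬multiplesIn
  where
  ω<q⇒¬multiplesIn : (∀ C → IsClique (r * q) S C → ∣ C ∣ < q) → ¬ MultiplesIn r q S
  ω<q⇒¬multiplesIn ω<q multiples =
    <-irrefl (∣multiplesOf∣ r q 1≤r) (ω<q (multiplesOf r q) (multiplesOf-clique r q odd S multiples))
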